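{- Let $n\geq 1$. The map $\phi_R$ is defined on every element of $\mathcal{R}'_{[n]}$ and maps $\mathcal{R}'_{[n]}$ to $\mathcal{D}_{[n]}$, the map $\psi_R$ maps $\mathcal{D}_{[n]}$ to $\mathcal{R}'_{[n]}$, and $\phi_R:\mathcal{R}'_{[n]}\to\mathcal{D}_{[n]}$ and $\psi_R:\mathcal{D}_{[n]}\to\mathcal{R}'_{[n]}$ are bijections (indeed mutually inverse).
   Context: For a finite set $P$ of positive integers with $|P|=n$, a permutation $w$ of $P$ is written as a word $w=w_1\cdots w_n$ with $\{w_1,\dots,w_n\}=P$; $w^*=w_n\cdots w_1$ is its reversal; $w[i,j]=w_i\cdots w_j$ is a (contiguous) subword, proper if $\neq w$; commas denote concatenation. For $|P|\geq 2$, $w$ is an R-word if (R1) $w_1=\max(P)$ and $w_n=\max(P\setminus\{w_1\})$, and (R2) if $n\geq4$ then $w_2<w_{n-1}$; it is a primitive R-word if for every proper subword $x$ of length $\geq 4$, neither $x$ nor $x^*$ is an R-word. For a finite nonempty $P$ with $m=\max(P)$, let $\mathcal{R}'_P$ be the set of permutations $w$ of $P$ such that $(m+2,w,m+1)$ is a primitive R-word (on $P\cup\{m+1,m+2\}$). A decreasing 012-tree on vertex set $P$ is a rooted tree with vertices labeled by the distinct elements of $P$, every vertex having $0$, $1$ or $2$ (unordered) children, with $x<y$ whenever $x$ is a descendant of $y$ (so the root is $\max P$); $\mathcal{D}_P$ is the set of these. Write $[v,T_1,\dots,T_r]$ for the tree with root $v$ whose children root the subtrees $T_1,\dots,T_r$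 (order irrelevant). For a word $w$ on a finite nonempty set $P$ with $m=\max(P)$, $|P|=n$, and $k$ the position of $m$ in $w$, define recursively $\phi_R(w)=[m]$ if $n=1$; $\phi_R(w)=[m,\phi_R(w[1,n-1]^*)]$ if $n>1$ and $k=n$; $\phi_R(w)=[m,\phi_R(w[1,k-1]^*),\phi_R(w[k+1,n])]$ if $n>1$ and $2\le k\le n-1$. For $T\in\mathcal{D}_P$, define recursively $\psi_R(T)=v$ if $T$ is a single vertex $v$; $\psi_R([v,T'])=(\psi_R(T')^*,v)$; and $\psi_R([v,T',T''])=(\psi_R(T')^*,v,\psi_R(T''))$, where the two subtrees are labeled $T',T''$ so that the last digit of $\psi_R(T')$ is less than the last digit of $\psi_R(T'')$. -}

module Defs where

open import Data.Nat using (ℕ; zero; suc; _+_; _∸_; _≤_; _<_; _⊔_; _<ᵇ_)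
open import Data.Nat.Properties using (_≟_)
open import Data.Bool using (Bool; true; false; if_then_else_)
open import Data.List using (List; []; _∷_; _++_; [_]; reverse; length; take; drop; filter; foldr; applyUpTo)
open import Data.List.Relation.Unary.All using (All)
open import Data.List.Relation.Unary.Unique.Propositional using (Unique)
open import Data.List.Relation.Binary.Permutation.Propositional using (_↭_)
open import Data.Maybe using (Maybe; just; nothing)
open import Data.Product using (_×_; Σ)
open import Data.Sum using (_⊎_)
open import Relation.Nullary using (¬_)
open import Relation.Nullary.Decidable using (does; ¬?)
open import Relation.Binary.PropositionalEquality using (_≡_; _≢_)

[_]ₙ : ℕ → List ℕ
[ n ]ₙ = applyUpTo suc n

-- maximum of a list (the entries are positive, so 0 is a safe default)
maxL : List ℕ → ℕ
maxL = foldr _⊔_ 0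

-- 1-indexed letter w_i (default 0 when out of range)
nth : List ℕ → ℕ → ℕ
nth []       _             = 0
nth (x ∷ xs) zero          = 0
nth (x ∷ xs) (suc zero)    = x
nth (x ∷ xs) (suc (suc i)) = nth xs (suc i)

lastD : List ℕ → ℕ
lastD []           = 0
lastD (x ∷ [])     = x
lastD (x ∷ y ∷ xs) = lastD (y ∷ xs)

-- w[i,j] = w_i ⋯ w_j (1-indexed)
sub : List ℕ → ℕ → ℕ → List ℕ
sub w i j = take (suc j ∸ i) (drop (i ∸ 1) w)

-- w is an R-word: w is a permutation of its letter set P, |P| ≥ 2,
-- (R1) w_1 = max P and w_n = max (P ∖ {w_1}), (R2) n ≥ 4 ⇒ w_2 < w_{n-1}.
IsRWord : List ℕ → Set
IsRWord w =
  Unique w × 2 ≤ length w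
  × nth w 1 ≡ maxL w
  × nth w (length w) ≡ maxL (filter (λ x → ¬? (x ≟ nth w 1)) w)
  × (4 ≤ length w → nth w 2 < nth w (length w ∸ 1))

IsPrimRWord : List ℕ → Set
IsPrimRWord w =
  IsRWord w ×
  ((i j : ℕ) → 1 ≤ i → i ≤ j → j ≤ length w →
     sub w i j ≢ w → 4 ≤ length (sub w i j) →
     ¬ IsRWord (sub w i j) × ¬ IsRWord (reverse (sub w i j)))

R′ : List ℕ → List ℕ → Set
R′ P w = w ↭ P × IsPrimRWord ((maxL P + 2) ∷ w ++ [ maxL P + 1 ])

-- Decreasing 012-trees
-- node0 v = [v], node1 v T = [v,T], node2 v T T' = [v,T,T'];
-- children are unordered: trees are compared up to _≈T_ (swapping
-- the two children of any binary node).

data Tree : Set where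
  node0 : ℕ → Tree
  node1 : ℕ → Tree → Tree
  node2 : ℕ → Tree → Tree → Tree

labels : Tree → List ℕ
labels (node0 v)       = v ∷ []
labels (node1 v t)     = v ∷ labels t
labels (node2 v t t′)  = v ∷ labels t ++ labels t′

data _≈T_ : Tree → Tree → Set where
  ≈0 : ∀ {v} → node0 v ≈T node0 v
  ≈1 : ∀ {v t u} → t ≈T u → node1 v t ≈T node1 v u
  ≈2 : ∀ {v a b c d} → (a ≈T c × b ≈T d) ⊎ (a ≈T d × b ≈T c) →
       node2 v a b ≈T node2 v c d

Decreasing : Tree → Set
Decreasing (node0 v)      = Data.Unit.⊤
  where import Data.Unit
Decreasing (node1 v t)    = All (_< v) (labels t) × Decreasing t
Decreasing (node2 v t t′) = All (_< v) (labels t) × All (_< v) (labels t′)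
                            × Decreasing t × Decreasing t′

𝓓 : List ℕ → Tree → Set
𝓓 P T = labels T ↭ P × Decreasing T

-- φ_R (partial; nothing = undefined)

splitOn : ℕ → List ℕ → Maybe (List ℕ × List ℕ)
splitOn m [] = nothing
splitOn m (x ∷ xs) with does (x ≟ m)
... | true  = just ([] Data.Product., xs)
... | false with splitOn m xs
...   | nothing = nothing
...   | just (u Data.Product., v) = just ((x ∷ u) Data.Product., v)

-- fuel-driven version; each recursive call is on a strictly shorter word,
-- so fuel = length w suffices
φRf : ℕ → List ℕ → Maybe Tree
φRf zero    _            = nothing
φRf (suc f) []           = nothing
φRf (suc f) (x ∷ [])     = just (node0 x)
φRf (suc f) w@(_ ∷ _ ∷ _) with splitOn (maxL w) w
... | nothing = nothing
... | just ([] Data.Product., _) = nothing          -- k = 1 : undefined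
... | just (u@(_ ∷ _) Data.Product., []) with φRf f (reverse u)
...   | nothing = nothing
...   | just t  = just (node1 (maxL w) t)
φRf (suc f) w@(_ ∷ _ ∷ _) | just (u@(_ ∷ _) Data.Product., v@(_ ∷ _))
  with φRf f (reverse u) | φRf f v
... | just t | just t′ = just (node2 (maxL w) t t′)
... | _      | _       = nothing

φR : List ℕ → Maybe Tree
φR w = φRf (length w) w

ψ2 : ℕ → List ℕ → List ℕ → List ℕ
ψ2 v a b = if lastD a <ᵇ lastD b
           then reverse a ++ v ∷ b
           else reverse b ++ v ∷ a

ψR : Tree → List ℕ
ψR (node0 v)      = v ∷ []
ψR (node1 v t)    = reverse (ψR t) ++ [ v ]
ψR (node2 v t t′) = ψ2 v (ψR t) (ψR t′)

-- Let m = max P and frame a permutation w of P as W = (m + 2 , w , m + 1). Because m + 2 and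
-- m + 1 are the two largest letters, W is an R-word iff the ends of w increase, and a proper
-- subword of W of length ≥ 4 is an R-word (or reversed R-word) only in a few explicit shapes:
-- (m + 2 , x) for a prefix x of w, (x , m + 1) reversed for a suffix x, or an infix of w. So
-- 𝓡′_P is described by a condition on w alone ("admissible"). Cutting an admissible word at
-- its maximum, w = U m V, leaves U reversed and V admissible with the first letter of U below
-- the last letter of V, and conversely these conditions rebuild an admissible word. The
-- comparison of first and last letters is exactly how ψ_R orders the two subtrees of a node,
-- so ψ_R maps 𝓓_P into 𝓡′_P, and φ_R, which cuts at the maximum, inverts it.

module Submission where

open import Defs
open import Data.Bool using (true; false)
open import Data.Empty using (⊥-elim)
open import Data.Maybe using (just; nothing)
import Data.Maybe as Maybe
open import Data.Nat using (ℕ; zero; suc; _+_; _∸_; _≤_; _<_; _>_; _<ᵇ_; z≤n; s≤s; s≤s⁻¹)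
open import Data.Nat.Properties
open import Data.List using (List; []; _∷_; _++_; [_]; _∷ʳ_; reverse; length; take; drop; filter)
open import Data.List.Properties
  using (∷-injective; ∷-injectiveʳ; ∷ʳ-injective; ++-assoc; ++-identityʳ; length-++; length-++-≤ˡ;
         length-++-≤ʳ; length-reverse; length-applyUpTo; reverse-++; reverse-involutive; unfold-reverse;
         take++drop≡id; drop-drop; filter-all; filter-reject)
open import Data.List.Reverse using (Reverse; []; _∶_∶ʳ_; reverseView)
open import Data.List.Relation.Unary.All as All using (All; []; _∷_)
open import Data.List.Relation.Unary.All.Properties using (++⁻ˡ; ++⁻ʳ) renaming (++⁺ to All-++⁺)
open import Data.List.Relation.Unary.Any using (here; there)
open import Data.List.Relation.Unary.AllPairs using ([]; _∷_)
open import Data.List.Relation.Unary.Unique.Propositional using (Unique)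
import Data.List.Relation.Unary.Unique.Propositional.Properties as Unique
open import Data.List.Relation.Binary.Permutation.Propositional
  using (_↭_; ↭-sym; ↭-trans; ↭-refl; ↭-reflexive; prep; ↭⇒↭ₛ′)
open import Data.List.Relation.Binary.Permutation.Propositional.Properties
  using (↭-reverse; shift; ++-comm; All-resp-↭; ∈-resp-↭; ↭-length) renaming (++⁺ to ↭-++⁺)
import Data.List.Relation.Binary.Permutation.Setoid.Properties as PermutationSetoid
open import Data.List.Membership.Propositional using (_∈_)
open import Data.List.Membership.Propositional.Properties using (∈-++⁺ˡ; ∈-++⁺ʳ; ∈-filter⁺; ∈-∃++)
open import Data.Product using (_×_; Σ; ∃; ∃₂; _,_; proj₁; proj₂)
open import Data.Sum using (_⊎_; inj₁; inj₂)
open import Function using (flip; _∘′_)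
open import Relation.Binary using (Rel; tri<; tri≈; tri>)
open import Relation.Nullary using (¬_; yes; no)
open import Relation.Nullary.Decidable using (¬?; dec-true; dec-false)
open import Relation.Binary.PropositionalEquality hiding ([_])

private
  variable
    a b c d e f k m : ℕ
    p r u v w x y U V : List ℕ
    T : Tree

Unique-++⁻ˡ : ∀ xs {ys : List ℕ} → Unique (xs ++ ys) → Unique xs
Unique-++⁻ˡ []       _          = []
Unique-++⁻ˡ (x ∷ xs) (x∉ ∷ xs!) = ++⁻ˡ xs x∉ ∷ Unique-++⁻ˡ xs xs!

Unique-++⁻ʳ : ∀ xs {ys : List ℕ} → Unique (xs ++ ys) → Unique ys
Unique-++⁻ʳ []       ys!       = ys!
Unique-++⁻ʳ (x ∷ xs) (_ ∷ xs!) = Unique-++⁻ʳ xs xs!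

Unique-++⇒disjoint : ∀ xs {ys : List ℕ} → Unique (xs ++ ys) → a ∈ xs → b ∈ ys → a ≢ b
Unique-++⇒disjoint (_ ∷ xs) (x∉ ∷ _)   (here refl) y∈ = All.lookup (++⁻ʳ xs x∉) y∈
Unique-++⇒disjoint (_ ∷ xs) (_ ∷ xs!) (there x∈)  y∈ = Unique-++⇒disjoint xs xs! x∈ y∈

Unique-head : Unique (a ∷ u) → All (a ≢_) u
Unique-head (a∉ ∷ _) = a∉

Unique-++-∷⁻ʳ : ∀ U → Unique (U ++ m ∷ v) → Unique v
Unique-++-∷⁻ʳ {m} U w! = Unique-++⁻ʳ [ m ] (Unique-++⁻ʳ U w!)

Unique-resp-↭ : u ↭ v → Unique u → Unique v
Unique-resp-↭ u↭v = PermutationSetoid.Unique-resp-↭ (setoid ℕ) (↭⇒↭ₛ′ isEquivalence u↭v)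

Unique-reverse : Unique u → Unique (reverse u)
Unique-reverse {u} = Unique-resp-↭ (↭-sym (↭-reverse u))

All-reverse : ∀ {P : ℕ → Set} → All P u → All P (reverse u)
All-reverse {u} = All-resp-↭ (↭-sym (↭-reverse u))

∈-reverse : a ∈ u → a ∈ reverse u
∈-reverse {u = u} = ∈-resp-↭ (↭-sym (↭-reverse u))

maxL-upper : a ∈ u → a ≤ maxL u
maxL-upper {u = y ∷ u} (here refl) = m≤m⊔n y (maxL u)
maxL-upper {u = y ∷ u} (there x∈)  = ≤-trans (maxL-upper x∈) (m≤n⊔m y (maxL u))

maxL-least : All (_≤ m) u → maxL u ≤ m
maxL-least []         = z≤n
maxL-least (x≤ ∷ u≤) = ⊔-lub x≤ (maxL-least u≤)

maxL-≡ : All (_≤ m) u → m ∈ u → maxL u ≡ m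
maxL-≡ u≤ m∈ = ≤-antisym (maxL-least u≤) (maxL-upper m∈)

maxL-∈ : ∀ (x : ℕ) u → maxL (x ∷ u) ∈ x ∷ u
maxL-∈ x []      = here (⊔-identityʳ x)
maxL-∈ x (y ∷ u) with ⊔-sel x (maxL (y ∷ u))
... | inj₁ eq = here eq
... | inj₂ eq = there (subst (_∈ y ∷ u) (sym eq) (maxL-∈ y u))

maxL-++-∷ : All (_< m) u → All (_< m) v → maxL (u ++ m ∷ v) ≡ m
maxL-++-∷ {u = u} u< v< =
  maxL-≡ (All-++⁺ (All.map <⇒≤ u<) (≤-refl ∷ All.map <⇒≤ v<)) (∈-++⁺ʳ u (here refl))

split-at-max : Unique w → All (_≤ m) w → m ∈ w →
  ∃₂ λ U V → w ≡ U ++ m ∷ V × All (_< m) U × All (_< m) V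
split-at-max w! w≤ m∈ with U , V , refl ← ∈-∃++ m∈ =
  U , V , refl ,
  All.tabulate (λ z∈ → ≤∧≢⇒< (All.lookup (++⁻ˡ U w≤) z∈) (Unique-++⇒disjoint U w! z∈ (here refl))) ,
  All.tabulate (λ z∈ → ≤∧≢⇒< (All.lookup V≤ z∈) (λ z≡m → m∉V (subst (_∈ V) z≡m z∈)))
  where
  V≤ = All.tail (++⁻ʳ U w≤)
  m∉V = Unique.Unique[x∷xs]⇒x∉xs (Unique-++⁻ʳ U w!)

++-≡-++-∷ : ∀ p r U V → p ++ r ≡ U ++ m ∷ V →
  (∃ λ C → U ≡ p ++ C × r ≡ C ++ m ∷ V) ⊎ (∃ λ D → p ≡ U ++ m ∷ D × V ≡ D ++ r)
++-≡-++-∷ []      r U       V eq   = inj₁ (U , refl , eq)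
++-≡-++-∷ (x ∷ p) r []      V refl = inj₂ (p , refl , refl)
++-≡-++-∷ (x ∷ p) r (y ∷ U) V eq with refl , eq′ ← ∷-injective eq with ++-≡-++-∷ p r U V eq′
... | inj₁ (C , refl , eq″) = inj₁ (C , refl , eq″)
... | inj₂ (D , refl , eq″) = inj₂ (D , refl , eq″)

data InfixSplit (p x r U : List ℕ) (m : ℕ) (V : List ℕ) : Set where
  before : ∀ C → U ≡ p ++ x ++ C → r ≡ C ++ m ∷ V → InfixSplit p x r U m V
  after  : ∀ D → p ≡ U ++ m ∷ D → V ≡ D ++ x ++ r → InfixSplit p x r U m V
  inside : ∀ x₁ x₂ → x ≡ x₁ ++ m ∷ x₂ → U ≡ p ++ x₁ → V ≡ x₂ ++ r → InfixSplit p x r U m V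

infixSplit : ∀ p x r U V → p ++ x ++ r ≡ U ++ m ∷ V → InfixSplit p x r U m V
infixSplit p x r U V eq with ++-≡-++-∷ p (x ++ r) U V eq
... | inj₂ (D , eq₁ , eq₂) = after D eq₁ eq₂
... | inj₁ (C , refl , eq₂) with ++-≡-++-∷ x r C V eq₂
...   | inj₁ (C′ , refl , eq₃) = before C′ refl eq₃
...   | inj₂ (D , eq₃ , eq₄)   = inside C D eq₃ refl eq₄

++-assoc₃ : ∀ (p x r : List ℕ) → (p ++ x ++ r) ++ v ≡ p ++ x ++ r ++ v
++-assoc₃ {v} p x r = trans (++-assoc p (x ++ r) v) (cong (p ++_) (++-assoc x r v))

++-assoc-∷ʳ : ∀ (p x v : List ℕ) → (p ++ x) ++ m ∷ v ≡ p ++ x ∷ʳ m ++ v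
++-assoc-∷ʳ {m} p x v = trans (++-assoc p x (m ∷ v)) (cong (p ++_) (sym (++-assoc x [ m ] v)))

++-∷-≢-[] : ∀ U → U ++ m ∷ V ≢ []
++-∷-≢-[] []      ()
++-∷-≢-[] (_ ∷ _) ()

∷-∷ʳ-injective : a ∷ u ∷ʳ b ≡ c ∷ v ∷ʳ d → a ≡ c × u ≡ v × b ≡ d
∷-∷ʳ-injective {u = u} {v = v} eq
  with refl , eq′ ← ∷-injective eq with refl , refl ← ∷ʳ-injective u v eq′ = refl , refl , refl

∷ʳ-prefix : ∀ u v → u ∷ʳ a ≡ v ++ b ∷ w → ∃ λ r → u ≡ v ++ r
∷ʳ-prefix u       []      _  = u , refl
∷ʳ-prefix []      (_ ∷ v) eq = ⊥-elim (++-∷-≢-[] v (sym (∷-injectiveʳ eq)))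
∷ʳ-prefix (x ∷ u) (_ ∷ v) eq
  with refl , eq′ ← ∷-injective eq with r , refl ← ∷ʳ-prefix u v eq′ = r , refl

split-last-two : ∀ (u : List ℕ) → 2 ≤ length u → ∃₂ λ mid c → ∃ λ d → u ≡ mid ∷ʳ c ∷ʳ d
split-last-two (x ∷ [])        (s≤s ())
split-last-two (x ∷ y ∷ [])    _ = [] , x , y , refl
split-last-two (x ∷ y ∷ z ∷ u) _ with mid , c , d , eq ← split-last-two (y ∷ z ∷ u) (s≤s (s≤s z≤n)) =
  x ∷ mid , c , d , cong (x ∷_) eq

reverse-∷-∷ʳ : ∀ (a : ℕ) u b → reverse (a ∷ u ∷ʳ b) ≡ b ∷ reverse u ∷ʳ a
reverse-∷-∷ʳ a u b = trans (unfold-reverse a (u ∷ʳ b)) (cong (_∷ʳ a) (reverse-++ u [ b ]))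

reverse-++-++ : ∀ (p x r : List ℕ) → reverse (p ++ x ++ r) ≡ reverse r ++ reverse x ++ reverse p
reverse-++-++ p x r = begin
  reverse (p ++ x ++ r)             ≡⟨ reverse-++ p (x ++ r) ⟩
  reverse (x ++ r) ++ reverse p     ≡⟨ cong (_++ reverse p) (reverse-++ x r) ⟩
  (reverse r ++ reverse x) ++ reverse p ≡⟨ ++-assoc (reverse r) (reverse x) (reverse p) ⟩
  reverse r ++ reverse x ++ reverse p ∎
  where open ≡-Reasoning

reverse-≡ : reverse u ≡ v → u ≡ reverse v
reverse-≡ {u} refl = sym (reverse-involutive u)

lastD-++-∷ : ∀ u → lastD (u ++ a ∷ v) ≡ lastD (a ∷ v)
lastD-++-∷ []          = refl
lastD-++-∷ (_ ∷ [])    = refl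
lastD-++-∷ (_ ∷ y ∷ u) = lastD-++-∷ (y ∷ u)

lastD-reverse-∷ : ∀ (x : ℕ) u → lastD (reverse (x ∷ u)) ≡ x
lastD-reverse-∷ x u = trans (cong lastD (unfold-reverse x u)) (lastD-++-∷ (reverse u))

length-∷ʳ : ∀ u → length (u ∷ʳ a) ≡ suc (length u)
length-∷ʳ u = trans (length-++ u) (+-comm (length u) 1)

nth-last : ∀ u → nth (u ∷ʳ a) (suc (length u)) ≡ a
nth-last []      = refl
nth-last (_ ∷ u) = nth-last u

nth-penultimate : ∀ u → nth (u ∷ʳ a ∷ʳ b) (suc (length u)) ≡ a
nth-penultimate []      = refl
nth-penultimate (_ ∷ u) = nth-penultimate u

nth-length : ∀ u → nth (u ∷ʳ a) (length (u ∷ʳ a)) ≡ a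
nth-length {a} u = trans (cong (nth (u ∷ʳ a)) (length-∷ʳ u)) (nth-last u)

nth-length∸1 : ∀ u → nth (u ∷ʳ a ∷ʳ b) (length (u ∷ʳ a ∷ʳ b) ∸ 1) ≡ a
nth-length∸1 {a} {b} u = trans (cong (λ n → nth (u ∷ʳ a ∷ʳ b) (n ∸ 1)) (length-∷ʳ (u ∷ʳ a)))
                               (trans (cong (nth (u ∷ʳ a ∷ʳ b)) (length-∷ʳ u)) (nth-penultimate u))

filter-≢-head : All (_≢ a) u → filter (λ z → ¬? (z ≟ a)) (a ∷ u) ≡ u
filter-≢-head {a} u≢ =
  trans (filter-reject (λ z → ¬? (z ≟ a)) (λ a≢a → a≢a refl)) (filter-all (λ z → ¬? (z ≟ a)) u≢)

-- For distinct letters, the R-words of length ≥ 4 are exactly the IsLongRWord words (R1 and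
-- R2 made explicit); IsRTail is such a word with its first letter removed.
data IsRTail (y : List ℕ) : Set where
  rtail : ∀ b mid c d → y ≡ b ∷ mid ∷ʳ c ∷ʳ d → All (_< d) (b ∷ mid ∷ʳ c) → b < c → IsRTail y

data IsLongRWord (x : List ℕ) : Set where
  longR : ∀ a y → x ≡ a ∷ y → All (_< a) y → IsRTail y → IsLongRWord x

Ends : Rel ℕ _ → List ℕ → Set
Ends _≺_ w = ∀ a mid b → w ≡ a ∷ mid ∷ʳ b → a ≺ b

IsRTail-length : IsRTail y → 3 ≤ length y
IsRTail-length (rtail b mid c d refl _ _) rewrite length-∷ʳ {d} (b ∷ mid ∷ʳ c) | length-∷ʳ {c} mid =
  s≤s (s≤s (s≤s z≤n))

IsLongRWord-length : IsLongRWord x → 4 ≤ length x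
IsLongRWord-length (longR a y refl _ y-tail) = s≤s (IsRTail-length y-tail)

IsRTail-∷ʳ⇒below : IsRTail (u ∷ʳ e) → All (_< e) u
IsRTail-∷ʳ⇒below {u} (rtail b mid c d eq below _) with refl , refl ← ∷ʳ-injective u (b ∷ mid ∷ʳ c) eq = below

IsRTail-∷ʳ⇒¬ends> : IsRTail (u ∷ʳ e) → ¬ Ends _>_ u
IsRTail-∷ʳ⇒¬ends> {u} (rtail b mid c d eq _ b<c) ends with refl , refl ← ∷ʳ-injective u (b ∷ mid ∷ʳ c) eq =
  <-asym b<c (ends b mid c refl)

IsRWord⇒IsLongRWord : 4 ≤ length x → IsRWord x → IsLongRWord x
IsRWord⇒IsLongRWord {a ∷ b ∷ z} (s≤s (s≤s 2≤)) (x! , _ , a≡max , d≡max′ , R2)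
  with mid , c , d , refl ← split-last-two z 2≤ =
  longR a y′ refl below-a (rtail b mid c d refl below-d b<c)
  where
  y′ : List ℕ
  y′ = b ∷ mid ∷ʳ c ∷ʳ d
  a∉y : All (a ≢_) y′
  a∉y = Unique-head x!
  below-a : All (_< a) y′
  below-a = All.tabulate λ z∈ →
    ≤∧≢⇒< (subst (_ ≤_) (sym a≡max) (maxL-upper {u = a ∷ y′} (there z∈)))
          (λ z≡a → All.lookup a∉y z∈ (sym z≡a))
  below-d : All (_< d) (b ∷ mid ∷ʳ c)
  below-d = All.tabulate λ z∈ →
    ≤∧≢⇒< (subst (_ ≤_) (trans (sym d≡max′) (nth-length (a ∷ b ∷ mid ∷ʳ c)))
             (maxL-upper (∈-filter⁺ (λ z → ¬? (z ≟ a)) {xs = a ∷ y′} (there (∈-++⁺ˡ z∈))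
                                   (λ z≡a → All.lookup a∉y (∈-++⁺ˡ z∈) (sym z≡a)))))
          (Unique-++⇒disjoint (b ∷ mid ∷ʳ c) (Unique-++⁻ʳ [ a ] x!) z∈ (here refl))
  b<c : b < c
  b<c = subst (b <_) (nth-length∸1 (a ∷ b ∷ mid)) (R2 (s≤s (s≤s 2≤)))

IsLongRWord⇒IsRWord : Unique x → IsLongRWord x → IsRWord x
IsLongRWord⇒IsRWord x! (longR a _ refl below-a (rtail b mid c d refl below-d b<c)) =
  x! , s≤s (s≤s z≤n) , sym a≡max , d≡max′ , λ _ → subst (b <_) (sym (nth-length∸1 (a ∷ b ∷ mid))) b<c
  where
  y′ : List ℕ
  y′ = b ∷ mid ∷ʳ c ∷ʳ d
  a≡max : maxL (a ∷ y′) ≡ a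
  a≡max = maxL-≡ (≤-refl ∷ All.map <⇒≤ below-a) (here refl)
  d≡max′ : nth (a ∷ y′) (length (a ∷ y′)) ≡ maxL (filter (λ z → ¬? (z ≟ a)) (a ∷ y′))
  d≡max′ = begin
    nth (a ∷ y′) (length (a ∷ y′))                ≡⟨ nth-length (a ∷ b ∷ mid ∷ʳ c) ⟩
    d                                           ≡⟨ maxL-≡ (All-++⁺ (All.map <⇒≤ below-d) (≤-refl ∷ []))
                                                          (∈-++⁺ʳ (b ∷ mid ∷ʳ c) (here refl)) ⟨
    maxL y′                                      ≡⟨ cong maxL (filter-≢-head (All.map <⇒≢ below-a)) ⟨
    maxL (filter (λ z → ¬? (z ≟ a)) (a ∷ y′))    ∎
    where open ≡-Reasoning

-- For a word w of distinct letters below m + 1, (m + 2 , w , m + 1) is a primitive R-word iff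
-- Admissible _<_ w: the prefix (suffix) condition rules out R-subwords through m + 2
-- (through m + 1), and `ends` is (R2) for the whole word.
record Admissible (_≺_ : Rel ℕ _) (w : List ℕ) : Set where
  field
    ends        : Ends _≺_ w
    prefix-free : ∀ x r → w ≡ x ++ r → ¬ IsRTail x
    suffix-free : ∀ p x → w ≡ p ++ x → ¬ IsRTail (reverse x)
    infix-free  : ∀ p x r → w ≡ p ++ x ++ r → ¬ IsLongRWord x × ¬ IsLongRWord (reverse x)
open Admissible

Ends-reverse : ∀ {_≺_} → Ends _≺_ w → Ends (flip _≺_) (reverse w)
Ends-reverse ends a mid b eq = ends b (reverse mid) a (trans (reverse-≡ eq) (reverse-∷-∷ʳ a mid b))

Admissible-reverse : ∀ {_≺_} → Admissible _≺_ w → Admissible (flip _≺_) (reverse w)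
Admissible-reverse w-adm = record
  { ends        = Ends-reverse (ends w-adm)
  ; prefix-free = λ x r eq x-tail → suffix-free w-adm (reverse r) (reverse x) (reverse-≡′ x r eq)
                    (subst IsRTail (sym (reverse-involutive x)) x-tail)
  ; suffix-free = λ p x eq → prefix-free w-adm (reverse x) (reverse p) (reverse-≡′ p x eq)
  ; infix-free  = λ p x r eq →
      let ¬x , ¬x* = infix-free w-adm (reverse r) (reverse x) (reverse p)
                       (trans (reverse-≡ eq) (reverse-++-++ p x r))
      in  (λ x-long → ¬x* (subst IsLongRWord (sym (reverse-involutive x)) x-long)) , ¬x
  }
  where
  reverse-≡′ : ∀ (u v : List ℕ) → reverse w ≡ u ++ v → w ≡ reverse v ++ reverse u
  reverse-≡′ u v eq = trans (reverse-≡ eq) (reverse-++ u v)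

length-infix : ∀ (p x r : List ℕ) → length x ≤ length (p ++ x ++ r)
length-infix p x r = ≤-trans (length-++-≤ˡ x) (length-++-≤ʳ (x ++ r) {p})

Admissible-short : ∀ {_≺_} → length w ≤ 1 → Admissible _≺_ w
Admissible-short {w} w≤1 = record
  { ends        = λ { a mid b refl →
      ⊥-elim (too-long w ≤-refl (s≤s (subst (1 ≤_) (sym (length-∷ʳ mid)) (s≤s z≤n)))) }
  ; prefix-free = λ { x r refl x-tail →
      too-long x (length-++-≤ˡ x) (≤-trans 2≤3 (IsRTail-length x-tail)) }
  ; suffix-free = λ { p x refl x*-tail →
      too-long (reverse x) (≤-trans (≤-reflexive (length-reverse x)) (length-++-≤ʳ x {p}))
               (≤-trans 2≤3 (IsRTail-length x*-tail)) }
  ; infix-free  = λ { p x r refl →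
      (λ x-long → too-long x (length-infix p x r) (≤-trans 2≤4 (IsLongRWord-length x-long))) ,
      (λ x*-long → too-long (reverse x) (≤-trans (≤-reflexive (length-reverse x)) (length-infix p x r))
                            (≤-trans 2≤4 (IsLongRWord-length x*-long))) }
  }
  where
  2≤3 : 2 ≤ 3
  2≤3 = s≤s (s≤s z≤n)
  2≤4 : 2 ≤ 4
  2≤4 = s≤s (s≤s z≤n)
  too-long : ∀ x → length x ≤ length w → ¬ (2 ≤ length x)
  too-long _ x≤w 2≤x = <⇒≱ (s≤s (s≤s z≤n)) (≤-trans 2≤x (≤-trans x≤w w≤1))

take-length-++ : ∀ (x r : List ℕ) → take (length x) (x ++ r) ≡ x
take-length-++ []      r = refl
take-length-++ (a ∷ x) r = cong (a ∷_) (take-length-++ x r)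

drop-length-++ : ∀ (x r : List ℕ) → drop (length x) (x ++ r) ≡ r
drop-length-++ []      r = refl
drop-length-++ (a ∷ x) r = drop-length-++ x r

sub-infix : ∀ p x r → sub (p ++ x ++ r) (suc (length p)) (length p + length x) ≡ x
sub-infix p x r = begin
  take (length p + length x ∸ length p) (drop (length p) (p ++ x ++ r))
    ≡⟨ cong₂ take (m+n∸m≡n (length p) (length x)) (drop-length-++ p (x ++ r)) ⟩
  take (length x) (x ++ r)
    ≡⟨ take-length-++ x r ⟩
  x ∎
  where open ≡-Reasoning

sub-decomposition : ∀ w i j → 1 ≤ i → i ≤ j → w ≡ take (i ∸ 1) w ++ sub w i j ++ drop j w
sub-decomposition w (suc i) j _ i<j = sym (begin
  take i w ++ take (suc j ∸ suc i) (drop i w) ++ drop j w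
    ≡⟨ cong (λ n → take i w ++ take (j ∸ i) (drop i w) ++ drop n w) (m+[n∸m]≡n (<⇒≤ i<j)) ⟨
  take i w ++ take (j ∸ i) (drop i w) ++ drop (i + (j ∸ i)) w
    ≡⟨ cong (λ z → take i w ++ take (j ∸ i) (drop i w) ++ z) (drop-drop i (j ∸ i) w) ⟨
  take i w ++ take (j ∸ i) (drop i w) ++ drop (j ∸ i) (drop i w)
    ≡⟨ cong (take i w ++_) (take++drop≡id (j ∸ i) (drop i w)) ⟩
  take i w ++ drop i w
    ≡⟨ take++drop≡id i w ⟩
  w ∎)
  where open ≡-Reasoning

IsPrimRWord⇒no-long-infix : IsPrimRWord w → Unique w →
  ∀ p x r → w ≡ p ++ x ++ r → length x < length (p ++ x ++ r) → ¬ IsLongRWord x × ¬ IsLongRWord (reverse x)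
IsPrimRWord⇒no-long-infix (_ , no-R-infix) w! p x r refl x<w =
  (λ x-long → proj₁ (no-R (IsLongRWord-length x-long)) (IsLongRWord⇒IsRWord x! x-long)) ,
  (λ x*-long → proj₂ (no-R (subst (4 ≤_) (length-reverse x) (IsLongRWord-length x*-long)))
                       (IsLongRWord⇒IsRWord (Unique-reverse x!) x*-long))
  where
  x! : Unique x
  x! = Unique-++⁻ˡ x (Unique-++⁻ʳ p w!)
  no-R : 4 ≤ length x → ¬ IsRWord x × ¬ IsRWord (reverse x)
  no-R 4≤x = subst (λ z → ¬ IsRWord z × ¬ IsRWord (reverse z)) (sub-infix p x r)
    (no-R-infix (suc (length p)) (length p + length x) (s≤s z≤n) i≤j j≤w sub≢w
                (subst (λ z → 4 ≤ length z) (sym (sub-infix p x r)) 4≤x))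
    where
    i≤j : suc (length p) ≤ length p + length x
    i≤j = subst (_≤ length p + length x) (+-comm (length p) 1) (+-monoʳ-≤ (length p) (≤-trans (s≤s z≤n) 4≤x))
    j≤w : length p + length x ≤ length (p ++ x ++ r)
    j≤w rewrite length-++ p {x ++ r} | length-++ x {r} = +-monoʳ-≤ (length p) (m≤m+n (length x) (length r))
    sub≢w : sub (p ++ x ++ r) (suc (length p)) (length p + length x) ≢ p ++ x ++ r
    sub≢w eq = <-irrefl (cong length (trans (sym (sub-infix p x r)) eq)) x<w

Unique-∷ʳ : All (_≢ a) u → Unique u → Unique (u ∷ʳ a)
Unique-∷ʳ []          []        = [] ∷ []
Unique-∷ʳ (x≢a ∷ u≢a) (x∉ ∷ u!) = All-++⁺ x∉ (x≢a ∷ []) ∷ Unique-∷ʳ u≢a u!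

length-<-++-∷ʳ : ∀ x r → length x < length (x ++ r ∷ʳ a)
length-<-++-∷ʳ x r =
  subst (length x <_) (sym (length-++ x)) (m<m+n (length x) (subst (0 <_) (sym (length-∷ʳ r)) (s≤s z≤n)))

2≤length-∷ʳ-∷ʳ : ∀ u → 2 ≤ length (u ∷ʳ a ∷ʳ b)
2≤length-∷ʳ-∷ʳ u =
  subst (2 ≤_) (sym (trans (length-∷ʳ (u ∷ʳ _)) (cong suc (length-∷ʳ u)))) (s≤s (s≤s z≤n))

IsLongRWord-∷⇒IsRTail : IsLongRWord (a ∷ y) → IsRTail y
IsLongRWord-∷⇒IsRTail (longR _ _ refl _ y-tail) = y-tail

-- The first letter of a long R-word is its largest.
¬IsLongRWord-∷ʳ-max : All (_< a) u → ¬ IsLongRWord (u ∷ʳ a)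
¬IsLongRWord-∷ʳ-max {u = []}    _         (longR _ _ refl _ []-tail) with () ← IsRTail-length []-tail
¬IsLongRWord-∷ʳ-max {u = x ∷ u} (x<a ∷ _) (longR _ _ refl below _)  =
  <-asym x<a (All.lookup below (∈-++⁺ʳ u (here refl)))

R2 : List ℕ → Set
R2 x = 4 ≤ length x → nth x 2 < nth x (length x ∸ 1)

module _ {M M′ : ℕ} (M′<M : M′ < M) where

  private
    below-M : All (_< M′) w → All (_< M) w
    below-M = All.map (λ z<M′ → <-trans z<M′ M′<M)

  Unique-framed : All (_< M′) w → Unique w → Unique (M ∷ w ∷ʳ M′)
  Unique-framed w<M′ w! =
    All-++⁺ (All.map (λ z<M → <⇒≢ z<M ∘′ sym) (below-M w<M′)) ((<⇒≢ M′<M ∘′ sym) ∷ [])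
    ∷ Unique-∷ʳ (All.map <⇒≢ w<M′) w!

  R2-framed⇒Ends : R2 (M ∷ w ∷ʳ M′) → Ends _<_ w
  R2-framed⇒Ends R2-W a mid b refl =
    subst (a <_) (nth-length∸1 (M ∷ a ∷ mid)) (R2-W (s≤s (s≤s (2≤length-∷ʳ-∷ʳ mid))))

  Ends⇒R2-framed : Ends _<_ w → R2 (M ∷ w ∷ʳ M′)
  Ends⇒R2-framed {[]}     _    (s≤s (s≤s ()))
  Ends⇒R2-framed {a ∷ w′} ends 4≤ with reverseView w′
  ... | []            = ⊥-elim (<⇒≱ (n<1+n 3) 4≤)
  ... | mid ∶ _ ∶ʳ b = subst (a <_) (sym (nth-length∸1 (M ∷ a ∷ mid))) (ends a mid b refl)

  IsRWord-framed : All (_< M′) w → Unique w → Ends _<_ w → IsRWord (M ∷ w ∷ʳ M′)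
  IsRWord-framed {w} w<M′ w! ends =
    Unique-framed w<M′ w! , s≤s (subst (1 ≤_) (sym (length-∷ʳ w)) (s≤s z≤n)) ,
    sym (maxL-≡ (≤-refl ∷ All-++⁺ (All.map <⇒≤ (below-M w<M′)) (<⇒≤ M′<M ∷ [])) (here refl)) ,
    trans (nth-length (M ∷ w)) (sym M′≡max) ,
    Ends⇒R2-framed ends
    where
    M′≡max : maxL (filter (λ z → ¬? (z ≟ M)) (M ∷ w ∷ʳ M′)) ≡ M′
    M′≡max = trans (cong maxL (filter-≢-head (All-++⁺ (All.map <⇒≢ (below-M w<M′)) (<⇒≢ M′<M ∷ []))))
                   (maxL-≡ (All-++⁺ (All.map <⇒≤ w<M′) (≤-refl ∷ [])) (∈-++⁺ʳ w (here refl)))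

  IsPrimRWord⇒Admissible : All (_< M′) w → Unique w → IsPrimRWord (M ∷ w ∷ʳ M′) → Admissible _<_ w
  IsPrimRWord⇒Admissible {w} w<M′ w! W-prim@(W-R , _) = record
    { ends        = R2-framed⇒Ends (proj₂ (proj₂ (proj₂ (proj₂ W-R))))
    ; prefix-free = λ x r eq x-tail →
        proj₁ (no-long [] (M ∷ x) (r ∷ʳ M′) (framed-≡ x r eq) (s≤s (length-<-++-∷ʳ x r)))
              (longR M x refl (++⁻ˡ x (subst (All (_< M)) eq (below-M w<M′))) x-tail)
    ; suffix-free = λ p x eq x*-tail →
        proj₂ (no-long (M ∷ p) (x ∷ʳ M′) [] (suffix-≡ p x eq) (s≤s (length-infix p (x ∷ʳ M′) [])))
              (longR M′ (reverse x) (reverse-++ x [ M′ ])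
                     (All-reverse (++⁻ʳ p (subst (All (_< M′)) eq w<M′))) x*-tail)
    ; infix-free  = λ p x r eq →
        no-long (M ∷ p) x (r ∷ʳ M′)
                (trans (framed-≡ p (x ++ r) eq) (cong (λ z → M ∷ p ++ z) (++-assoc x r [ M′ ])))
                (s≤s (length-infix p x (r ∷ʳ M′)))
    }
    where
    no-long : ∀ p x r → M ∷ w ∷ʳ M′ ≡ p ++ x ++ r → length x < length (p ++ x ++ r) →
              ¬ IsLongRWord x × ¬ IsLongRWord (reverse x)
    no-long = IsPrimRWord⇒no-long-infix W-prim (Unique-framed w<M′ w!)
    framed-≡ : ∀ x r → w ≡ x ++ r → M ∷ w ∷ʳ M′ ≡ M ∷ x ++ r ∷ʳ M′
    framed-≡ x r eq = cong (M ∷_) (trans (cong (_∷ʳ M′) eq) (++-assoc x r [ M′ ]))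
    suffix-≡ : ∀ p x → w ≡ p ++ x → M ∷ w ∷ʳ M′ ≡ M ∷ p ++ (x ∷ʳ M′) ++ []
    suffix-≡ p x eq = trans (framed-≡ p x eq) (cong (λ z → M ∷ p ++ z) (sym (++-identityʳ (x ∷ʳ M′))))

  framed-no-long-infix : All (_< M′) w → Admissible _<_ w →
    ∀ p x r → M ∷ w ∷ʳ M′ ≡ p ++ x ++ r → x ≢ M ∷ w ∷ʳ M′ → 4 ≤ length x →
    ¬ IsLongRWord x × ¬ IsLongRWord (reverse x)
  framed-no-long-infix _ _ [] []      _       _  _   ()
  framed-no-long-infix _ _ [] (_ ∷ x) []      eq x≢W _ = ⊥-elim (x≢W (sym (trans eq (++-identityʳ _))))
  framed-no-long-infix {w} w<M′ w-adm [] (_ ∷ x) (_ ∷ r) eq _ _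
    with refl , eq′ ← ∷-injective eq with r′ , refl ← ∷ʳ-prefix w x eq′ =
    (λ Mx-long → prefix-free w-adm x r′ refl (IsLongRWord-∷⇒IsRTail Mx-long)) ,
    (λ Mx*-long → ¬IsLongRWord-∷ʳ-max (All-reverse (++⁻ˡ x (below-M w<M′)))
                                      (subst IsLongRWord (unfold-reverse M x) Mx*-long))
  framed-no-long-infix {w} w<M′ w-adm (_ ∷ p) x [] eq _ 4≤ with reverseView x
  ... | [] with () ← 4≤
  ... | x′ ∶ _ ∶ʳ e
    with refl , refl ← ∷ʳ-injective w (p ++ x′) (trans (∷-injectiveʳ eq)
                         (trans (cong (p ++_) (++-identityʳ _)) (sym (++-assoc p x′ [ e ])))) =
    (λ x′M′-long → ¬IsLongRWord-∷ʳ-max (++⁻ʳ p w<M′) x′M′-long) ,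
    (λ x′M′*-long → suffix-free w-adm p x′ refl
                      (IsLongRWord-∷⇒IsRTail (subst IsLongRWord (reverse-++ x′ [ M′ ]) x′M′*-long)))
  framed-no-long-infix {w} _ w-adm (_ ∷ p) x (b ∷ r) eq _ _
    with r′ , refl ← ∷ʳ-prefix w (p ++ x) (trans (∷-injectiveʳ eq) (sym (++-assoc p x (b ∷ r)))) =
    infix-free w-adm p x r′ (++-assoc p x r′)

  Admissible⇒IsPrimRWord : All (_< M′) w → Unique w → Admissible _<_ w → IsPrimRWord (M ∷ w ∷ʳ M′)
  Admissible⇒IsPrimRWord {w} w<M′ w! w-adm = IsRWord-framed w<M′ w! (ends w-adm) , no-R-infix
    where
    W = M ∷ w ∷ʳ M′
    no-R-infix : (i j : ℕ) → 1 ≤ i → i ≤ j → j ≤ length W → sub W i j ≢ W → 4 ≤ length (sub W i j) →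
                 ¬ IsRWord (sub W i j) × ¬ IsRWord (reverse (sub W i j))
    no-R-infix i j 1≤i i≤j _ sub≢W 4≤ =
      (λ x-R → proj₁ no-long (IsRWord⇒IsLongRWord 4≤ x-R)) ,
      (λ x*-R → proj₂ no-long (IsRWord⇒IsLongRWord (subst (4 ≤_) (sym (length-reverse (sub W i j))) 4≤) x*-R))
      where
      no-long = framed-no-long-infix w<M′ w-adm (take (i ∸ 1) W) (sub W i j) (drop j W)
                                    (sub-decomposition W i j 1≤i i≤j) sub≢W 4≤

-- Splitting an admissible word at its maximum

FirstBelowLast : List ℕ → List ℕ → Set
FirstBelowLast U V = ∀ a U′ V′ b → U ≡ a ∷ U′ → V ≡ V′ ∷ʳ b → a < b

FirstBelowLast-[] : FirstBelowLast U []
FirstBelowLast-[] _ _ V′ _ _ []≡ = ⊥-elim (++-∷-≢-[] V′ (sym []≡))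

lastD<⇒FirstBelowLast : lastD u < lastD v → FirstBelowLast (reverse u) v
lastD<⇒FirstBelowLast {u} {v} lt a U′ V′ b u*≡ v≡ = subst₂ _<_ lastD-u lastD-v lt
  where
  lastD-u : lastD u ≡ a
  lastD-u = trans (cong lastD (reverse-≡ {u} u*≡)) (lastD-reverse-∷ a U′)
  lastD-v : lastD v ≡ b
  lastD-v = trans (cong lastD v≡) (lastD-++-∷ V′)

IsLongRWord-∷-max : IsLongRWord (a ∷ y) → b ∈ y → b < a
IsLongRWord-∷-max (longR _ _ refl below _) b∈ = All.lookup below b∈

module _ {m : ℕ} where

  join-ends : All (_< m) (k ∷ U) → FirstBelowLast (k ∷ U) v → Ends _<_ (k ∷ U ++ m ∷ v)
  join-ends {k} {U} {v} U<m cross a mid b eq with reverseView v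
  ... | []            with refl , _ , refl ← ∷-∷ʳ-injective {u = U} eq = All.head U<m
  ... | V′ ∶ _ ∶ʳ b′
    with refl , _ , refl ← ∷-∷ʳ-injective {u = U ++ m ∷ V′}
                              (trans (cong (k ∷_) (++-assoc U (m ∷ V′) [ b′ ])) eq) =
    cross k U V′ b′ refl refl

  join-prefix-free : All (_< m) v → Admissible _>_ U →
    ∀ x r → U ++ m ∷ v ≡ x ++ r → ¬ IsRTail x
  join-prefix-free {v} {U} v<m U-adm x r eq x-tail with infixSplit [] x r U v (sym eq)
  ... | before C U≡ _          = prefix-free U-adm x C U≡ x-tail
  ... | after D []≡ _          = ++-∷-≢-[] U (sym []≡)
  ... | inside x₁ x₂ refl refl v≡ with reverseView x₂
  ...   | []             = IsRTail-∷ʳ⇒¬ends> x-tail (ends U-adm)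
  ...   | x₂′ ∶ _ ∶ʳ e  = <-asym m<e e<m
    where
    m<e = All.lookup (IsRTail-∷ʳ⇒below (subst IsRTail (sym (++-assoc U (m ∷ x₂′) [ e ])) x-tail))
                     (∈-++⁺ʳ U (here refl))
    e<m = All.lookup v<m (subst (e ∈_) (sym v≡) (∈-++⁺ˡ (∈-++⁺ʳ x₂′ (here refl))))

  join-suffix-free : All (_< m) U → Admissible _<_ v →
    ∀ p x → U ++ m ∷ v ≡ p ++ x → ¬ IsRTail (reverse x)
  join-suffix-free {U} {v} U<m v-adm p x eq x*-tail
    with infixSplit p x [] U v (sym (trans eq (cong (p ++_) (sym (++-identityʳ x)))))
  ... | before C _ []≡             = ++-∷-≢-[] C (sym []≡)
  ... | after D _ v≡               = suffix-free v-adm D x (trans v≡ (cong (D ++_) (++-identityʳ x))) x*-tail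
  ... | inside [] x₂ refl _ v≡     =
    IsRTail-∷ʳ⇒¬ends> (subst IsRTail (unfold-reverse m x₂) x*-tail)
                      (subst (λ z → Ends _>_ (reverse z)) (trans v≡ (++-identityʳ x₂)) (Ends-reverse (ends v-adm)))
  ... | inside (e ∷ x₁) x₂ refl U≡ _ = <-asym m<e e<m
    where
    m<e = All.lookup (IsRTail-∷ʳ⇒below (subst IsRTail (unfold-reverse e (x₁ ++ m ∷ x₂)) x*-tail))
                     (∈-reverse (∈-++⁺ʳ x₁ (here refl)))
    e<m = All.lookup U<m (subst (e ∈_) (sym U≡) (∈-++⁺ʳ p (here refl)))

  join-infix-free : All (_< m) U → All (_< m) v → Admissible _>_ U → Admissible _<_ v →
    ∀ p x r → U ++ m ∷ v ≡ p ++ x ++ r → ¬ IsLongRWord x × ¬ IsLongRWord (reverse x)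
  join-infix-free {U} {v} U<m v<m U-adm v-adm p x r eq with infixSplit p x r U v (sym eq)
  ... | before C U≡ _          = infix-free U-adm p x C U≡
  ... | after D _ v≡           = infix-free v-adm D x r v≡
  ... | inside x₁ x₂ refl U≡ v≡ = no-long x₁ U≡ , no-long* x₂ (reverseView x₂) v≡
    where
    no-long : ∀ x₁ → U ≡ p ++ x₁ → ¬ IsLongRWord (x₁ ++ m ∷ x₂)
    no-long []        _  long = prefix-free v-adm x₂ r v≡ (IsLongRWord-∷⇒IsRTail long)
    no-long (e ∷ x₁′) U≡ long =
      <-asym (IsLongRWord-∷-max long (∈-++⁺ʳ x₁′ (here refl)))
             (All.lookup U<m (subst (e ∈_) (sym U≡) (∈-++⁺ʳ p (here refl))))
    no-long* : ∀ x₂ → Reverse x₂ → v ≡ x₂ ++ r → ¬ IsLongRWord (reverse (x₁ ++ m ∷ x₂))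
    no-long* _ [] _ long =
      suffix-free U-adm p x₁ U≡ (IsLongRWord-∷⇒IsRTail (subst IsLongRWord (reverse-++ x₁ [ m ]) long))
    no-long* _ (x₂′ ∶ _ ∶ʳ e) v≡′ long =
      <-asym (IsLongRWord-∷-max (subst IsLongRWord eq* long) (∈-reverse (∈-++⁺ʳ x₁ (here refl))))
             (All.lookup v<m (subst (e ∈_) (sym v≡′) (∈-++⁺ˡ (∈-++⁺ʳ x₂′ (here refl)))))
      where
      eq* : reverse (x₁ ++ m ∷ x₂′ ∷ʳ e) ≡ e ∷ reverse (x₁ ++ m ∷ x₂′)
      eq* = trans (cong reverse (sym (++-assoc x₁ (m ∷ x₂′) [ e ]))) (reverse-++ (x₁ ++ m ∷ x₂′) [ e ])

  Admissible-join : U ≢ [] → All (_< m) U → All (_< m) v → Admissible _>_ U → Admissible _<_ v →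
    FirstBelowLast U v → Admissible _<_ (U ++ m ∷ v)
  Admissible-join {[]}    U≢[] = ⊥-elim (U≢[] refl)
  Admissible-join {k ∷ U} _    U<m v<m U-adm v-adm cross = record
    { ends        = join-ends U<m cross
    ; prefix-free = join-prefix-free v<m U-adm
    ; suffix-free = join-suffix-free U<m v-adm
    ; infix-free  = join-infix-free U<m v<m U-adm v-adm
    }

Unique-ends : Unique (a ∷ u ∷ʳ b) → a ≢ b
Unique-ends {u = u} a∷u! = All.lookup (Unique-head a∷u!) (∈-++⁺ʳ u (here refl))

module _ {m : ℕ} {U v : List ℕ} (w! : Unique (U ++ m ∷ v)) (w-adm : Admissible _<_ (U ++ m ∷ v)) where

  split-left : All (_< m) U → Admissible _>_ U
  split-left U<m = record
    { ends        = λ a mid b U≡ →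
        ≤∧≢⇒< (≮⇒≥ (a≮b a mid b U≡)) (Unique-ends (subst Unique U≡ (Unique-++⁻ˡ U w!)) ∘′ sym)
    ; prefix-free = λ x r U≡ →
        prefix-free w-adm x (r ++ m ∷ v) (trans (cong (_++ m ∷ v) U≡) (++-assoc x r (m ∷ v)))
    ; suffix-free = λ p x U≡ x*-tail →
        proj₂ (infix-free w-adm p (x ∷ʳ m) v (trans (cong (_++ m ∷ v) U≡) (++-assoc-∷ʳ p x v)))
              (subst IsLongRWord (sym (reverse-++ x [ m ]))
                     (longR m (reverse x) refl (All-reverse (++⁻ʳ p (subst (All (_< m)) U≡ U<m))) x*-tail))
    ; infix-free  = λ p x r U≡ →
        infix-free w-adm p x (r ++ m ∷ v) (trans (cong (_++ m ∷ v) U≡) (++-assoc₃ p x r))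
    }
    where
    a≮b : ∀ a mid b → U ≡ a ∷ mid ∷ʳ b → ¬ a < b
    a≮b a mid b U≡ a<b = prefix-free w-adm (U ∷ʳ m) v (sym (++-assoc U [ m ] v))
                           (rtail a mid b m (cong (_∷ʳ m) U≡) (subst (All (_< m)) U≡ U<m) a<b)

  split-right : All (_< m) v → Admissible _<_ v
  split-right v<m = record
    { ends        = λ a mid b v≡ → ≤∧≢⇒< (≮⇒≥ (b≮a a mid b v≡)) (Unique-ends (subst Unique v≡ v!))
    ; prefix-free = λ x r v≡ x-tail →
        proj₁ (infix-free w-adm U (m ∷ x) r (cong (λ z → U ++ m ∷ z) v≡))
              (longR m x refl (++⁻ˡ x (subst (All (_< m)) v≡ v<m)) x-tail)
    ; suffix-free = λ p x v≡ → suffix-free w-adm (U ++ m ∷ p) x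
                                 (trans (cong (λ z → U ++ m ∷ z) v≡) (sym (++-assoc U (m ∷ p) x)))
    ; infix-free  = λ p x r v≡ → infix-free w-adm (U ++ m ∷ p) x r
                                   (trans (cong (λ z → U ++ m ∷ z) v≡) (sym (++-assoc U (m ∷ p) (x ++ r))))
    }
    where
    v! : Unique v
    v! = Unique-++-∷⁻ʳ U w!
    b≮a : ∀ a mid b → v ≡ a ∷ mid ∷ʳ b → ¬ b < a
    b≮a a mid b v≡ b<a = suffix-free w-adm U (m ∷ v) refl (rtail b (reverse mid) a m m∷v* below-m b<a)
      where
      v*≡ : reverse v ≡ b ∷ reverse mid ∷ʳ a
      v*≡ = trans (cong reverse v≡) (reverse-∷-∷ʳ a mid b)
      m∷v* : reverse (m ∷ v) ≡ b ∷ reverse mid ∷ʳ a ∷ʳ m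
      m∷v* = trans (unfold-reverse m v) (cong (_∷ʳ m) v*≡)
      below-m : All (_< m) (b ∷ reverse mid ∷ʳ a)
      below-m = subst (All (_< m)) v*≡ (All-reverse v<m)

  split-cross : FirstBelowLast U v
  split-cross a U′ V′ b U≡ v≡ = ends w-adm a (U′ ++ m ∷ V′) b
    (trans (cong₂ (λ U v → U ++ m ∷ v) U≡ v≡) (cong (a ∷_) (sym (++-assoc U′ (m ∷ V′) [ b ]))))

Admissible-∷-max⇒[] : All (_< m) v → Admissible _<_ (m ∷ v) → v ≡ []
Admissible-∷-max⇒[] {v = v} v<m m∷v-adm with reverseView v
... | []            = refl
... | V′ ∶ _ ∶ʳ b  = ⊥-elim (<-asym (ends m∷v-adm _ V′ b refl) (All.lookup v<m (∈-++⁺ʳ V′ (here refl))))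

-- The map ψ_R

ψ2-< : ∀ a u v → lastD u < lastD v → ψ2 a u v ≡ reverse u ++ a ∷ v
ψ2-< a u v lt with lastD u <ᵇ lastD v | <⇒<ᵇ lt
... | true | _ = refl

ψ2-≮ : ∀ a u v → ¬ lastD u < lastD v → ψ2 a u v ≡ reverse v ++ a ∷ u
ψ2-≮ a u v ≮ with lastD u <ᵇ lastD v | <ᵇ⇒< (lastD u) (lastD v)
... | false | _   = refl
... | true  | lt  = ⊥-elim (≮ (lt _))

reverse-++-∷-↭ : ∀ u → reverse u ++ a ∷ v ↭ a ∷ u ++ v
reverse-++-∷-↭ {a} {v} u = ↭-trans (shift a (reverse u) v) (prep a (↭-++⁺ (↭-reverse u) ↭-refl))

ψR-↭ : ∀ T → ψR T ↭ labels T
ψR-↭ (node0 v)     = ↭-refl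
ψR-↭ (node1 v t)   =
  ↭-trans (reverse-++-∷-↭ (ψR t)) (prep v (↭-trans (↭-reflexive (++-identityʳ _)) (ψR-↭ t)))
ψR-↭ (node2 v s t) with lastD (ψR s) <? lastD (ψR t)
... | yes lt = ↭-trans (↭-reflexive (ψ2-< v (ψR s) (ψR t) lt))
                 (↭-trans (reverse-++-∷-↭ (ψR s)) (prep v (↭-++⁺ (ψR-↭ s) (ψR-↭ t))))
... | no ≮   = ↭-trans (↭-reflexive (ψ2-≮ v (ψR s) (ψR t) ≮))
                 (↭-trans (reverse-++-∷-↭ (ψR t))
                          (prep v (↭-trans (↭-++⁺ (ψR-↭ t) (ψR-↭ s)) (++-comm (labels t) (labels s)))))

ψR-All : ∀ {P : ℕ → Set} T → All P (labels T) → All P (ψR T)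
ψR-All T = All-resp-↭ (↭-sym (ψR-↭ T))

↭-∷⇒≢-[] : u ↭ a ∷ v → u ≢ []
↭-∷⇒≢-[] u↭ refl with () ← ↭-length u↭

ψR-≢-[] : ∀ T → ψR T ≢ []
ψR-≢-[] T@(node0 _)     = ↭-∷⇒≢-[] (ψR-↭ T)
ψR-≢-[] T@(node1 _ _)   = ↭-∷⇒≢-[] (ψR-↭ T)
ψR-≢-[] T@(node2 _ _ _) = ↭-∷⇒≢-[] (ψR-↭ T)

reverse-≢-[] : u ≢ [] → reverse u ≢ []
reverse-≢-[] u≢[] eq = u≢[] (reverse-≡ eq)

lastD-∈ : u ≢ [] → lastD u ∈ u
lastD-∈ {[]}        u≢[] = ⊥-elim (u≢[] refl)
lastD-∈ {_ ∷ []}    _    = here refl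
lastD-∈ {_ ∷ y ∷ u} _    = there (lastD-∈ {y ∷ u} λ ())

lastD-ψR-∈ : ∀ T → lastD (ψR T) ∈ labels T
lastD-ψR-∈ T = ∈-resp-↭ (ψR-↭ T) (lastD-∈ (ψR-≢-[] T))

ψ2-comm : ∀ a u v → lastD u ≢ lastD v → ψ2 a u v ≡ ψ2 a v u
ψ2-comm a u v ≢ with <-cmp (lastD u) (lastD v)
... | tri< lt _ _ = trans (ψ2-< a u v lt) (sym (ψ2-≮ a v u (<⇒≯ lt)))
... | tri≈ _ eq _ = ⊥-elim (≢ eq)
... | tri> _ _ gt = trans (ψ2-≮ a u v (<⇒≯ gt)) (sym (ψ2-< a v u gt))

Unique-children : ∀ v s t → Unique (labels (node2 v s t)) → Unique (labels s) × Unique (labels t)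
Unique-children v s t (_ ∷ st!) = Unique-++⁻ˡ (labels s) st! , Unique-++⁻ʳ (labels s) st!

lastD-ψR-children-≢ : ∀ v s t → Unique (labels (node2 v s t)) → lastD (ψR s) ≢ lastD (ψR t)
lastD-ψR-children-≢ v s t (_ ∷ st!) = Unique-++⇒disjoint (labels s) st! (lastD-ψR-∈ s) (lastD-ψR-∈ t)

ψR-cong : ∀ T T′ → Unique (labels T) → T ≈T T′ → ψR T ≡ ψR T′
ψR-cong (node0 v)     _               _         ≈0 = refl
ψR-cong (node1 v t)   (node1 v t′)    (_ ∷ t!)  (≈1 t≈t′) =
  cong (λ z → reverse z ++ [ v ]) (ψR-cong t t′ t! t≈t′)
ψR-cong (node2 v s t) (node2 v s′ t′) st!       (≈2 (inj₁ (s≈s′ , t≈t′))) =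
  let s! , t! = Unique-children v s t st! in cong₂ (ψ2 v) (ψR-cong s s′ s! s≈s′) (ψR-cong t t′ t! t≈t′)
ψR-cong (node2 v s t) (node2 v s′ t′) st!       (≈2 (inj₂ (s≈t′ , t≈s′))) =
  let s! , t! = Unique-children v s t st! in
  trans (ψ2-comm v (ψR s) (ψR t) (lastD-ψR-children-≢ v s t st!))
        (cong₂ (ψ2 v) (ψR-cong t s′ t! t≈s′) (ψR-cong s t′ s! s≈t′))

Admissible-join-reverse : u ≢ [] → All (_< m) u → All (_< m) v → Admissible _<_ u → Admissible _<_ v →
  FirstBelowLast (reverse u) v → Admissible _<_ (reverse u ++ m ∷ v)
Admissible-join-reverse u≢[] u<m v<m u-adm v-adm =
  Admissible-join (reverse-≢-[] u≢[]) (All-reverse u<m) v<m (Admissible-reverse u-adm) v-adm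

ψR-admissible : ∀ T → Unique (labels T) → Decreasing T → Admissible _<_ (ψR T)
ψR-admissible (node0 v)     _        _              = Admissible-short (s≤s z≤n)
ψR-admissible (node1 v t)   (_ ∷ t!) (t<v , t-dec) =
  Admissible-join-reverse (ψR-≢-[] t) (ψR-All t t<v) [] (ψR-admissible t t! t-dec) (Admissible-short z≤n)
                          FirstBelowLast-[]
ψR-admissible (node2 v s t) st!      (s<v , t<v , s-dec , t-dec) with <-cmp (lastD (ψR s)) (lastD (ψR t))
... | tri< lt _ _ = subst (Admissible _<_) (sym (ψ2-< v (ψR s) (ψR t) lt))
      (Admissible-join-reverse (ψR-≢-[] s) (ψR-All s s<v) (ψR-All t t<v) s-adm t-adm
                               (lastD<⇒FirstBelowLast {ψR s} lt))
  where
  s-adm = ψR-admissible s (proj₁ (Unique-children v s t st!)) s-dec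
  t-adm = ψR-admissible t (proj₂ (Unique-children v s t st!)) t-dec
... | tri≈ _ eq _ = ⊥-elim (lastD-ψR-children-≢ v s t st! eq)
... | tri> _ _ gt = subst (Admissible _<_) (sym (ψ2-≮ v (ψR s) (ψR t) (<⇒≯ gt)))
      (Admissible-join-reverse (ψR-≢-[] t) (ψR-All t t<v) (ψR-All s s<v) t-adm s-adm
                               (lastD<⇒FirstBelowLast {ψR t} gt))
  where
  s-adm = ψR-admissible s (proj₁ (Unique-children v s t st!)) s-dec
  t-adm = ψR-admissible t (proj₂ (Unique-children v s t st!)) t-dec

-- The map φ_R

splitOn-++-∷ : ∀ U → All (_< m) U → splitOn m (U ++ m ∷ v) ≡ just (U , v)
splitOn-++-∷ {m} []      _           rewrite dec-true (m ≟ m) refl = refl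
splitOn-++-∷ {m} {v} (x ∷ U) (x<m ∷ U<m)
  rewrite dec-false (x ≟ m) (<⇒≢ x<m) | splitOn-++-∷ {v = v} U U<m = refl

φRf-unfold₁ : ∀ f w → 2 ≤ length w → maxL w ≡ m → splitOn m w ≡ just (k ∷ U , []) →
  φRf (suc f) w ≡ Maybe.map (node1 m) (φRf f (reverse (k ∷ U)))
φRf-unfold₁ f (_ ∷ [])    (s≤s ()) _
φRf-unfold₁ {m} {k} {U} f (_ ∷ _ ∷ _) _ refl split rewrite split with φRf f (reverse (k ∷ U))
... | nothing = refl
... | just _  = refl

φRf-unfold₂ : ∀ f w → 2 ≤ length w → maxL w ≡ m → splitOn m w ≡ just (k ∷ U , a ∷ v) →
  φRf (suc f) w ≡ Maybe.zipWith (node2 m) (φRf f (reverse (k ∷ U))) (φRf f (a ∷ v))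
φRf-unfold₂ f (_ ∷ [])    (s≤s ()) _
φRf-unfold₂ {m} {k} {U} {a} {v} f (_ ∷ _ ∷ _) _ refl split rewrite split
  with φRf f (reverse (k ∷ U)) | φRf f (a ∷ v)
... | nothing | _       = refl
... | just _  | nothing = refl
... | just _  | just _  = refl

2≤length-++-∷ : ∀ U → U ≢ [] → 2 ≤ length (U ++ m ∷ v)
2≤length-++-∷ []      U≢[] = ⊥-elim (U≢[] refl)
2≤length-++-∷ (_ ∷ U) _    = s≤s (≤-trans (s≤s z≤n) (length-++-≤ʳ (_ ∷ _) {U}))

φRf-node1 : ∀ f → U ≢ [] → All (_< m) U →
  φRf (suc f) (U ++ [ m ]) ≡ Maybe.map (node1 m) (φRf f (reverse U))
φRf-node1 {[]}    f U≢[] = ⊥-elim (U≢[] refl)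
φRf-node1 {k ∷ U} {m} f U≢[] U<m =
  φRf-unfold₁ f (k ∷ U ++ [ m ]) (2≤length-++-∷ (k ∷ U) U≢[]) (maxL-++-∷ U<m [])
              (splitOn-++-∷ (k ∷ U) U<m)

φRf-node2 : ∀ f → U ≢ [] → v ≢ [] → All (_< m) U → All (_< m) v →
  φRf (suc f) (U ++ m ∷ v) ≡ Maybe.zipWith (node2 m) (φRf f (reverse U)) (φRf f v)
φRf-node2 {[]}            f U≢[] = ⊥-elim (U≢[] refl)
φRf-node2 {k ∷ U} {[]}    f _ v≢[] = ⊥-elim (v≢[] refl)
φRf-node2 {k ∷ U} {a ∷ v} {m} f U≢[] _ U<m v<m =
  φRf-unfold₂ f (k ∷ U ++ m ∷ a ∷ v) (2≤length-++-∷ (k ∷ U) U≢[]) (maxL-++-∷ U<m v<m)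
              (splitOn-++-∷ (k ∷ U) U<m)

length-++-∷-≤ : ∀ u → length (u ++ a ∷ v) ≤ suc f → length u ≤ f × length v ≤ f
length-++-∷-≤ {a} {v} {f} u len≤ = ≤-trans (m≤m+n _ _) len≤′ , ≤-trans (m≤n+m _ _) len≤′
  where
  len≤′ : length u + length v ≤ f
  len≤′ = s≤s⁻¹ (subst (_≤ suc f) (trans (length-++ u) (+-suc (length u) (length v))) len≤)

length-reverse-++-∷-≤ : ∀ u → length (reverse u ++ a ∷ v) ≤ suc f → length u ≤ f × length v ≤ f
length-reverse-++-∷-≤ u len≤ with u≤ , v≤ ← length-++-∷-≤ (reverse u) len≤ =
  subst (_≤ _) (length-reverse u) u≤ , v≤

≢-[]⇒0<length : u ≢ [] → 0 < length u
≢-[]⇒0<length {[]}    u≢[] = ⊥-elim (u≢[] refl)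
≢-[]⇒0<length {_ ∷ _} _    = s≤s z≤n

φRf-reverse-++-∷ : ∀ {s t} f → u ≢ [] → v ≢ [] → All (_< m) u → All (_< m) v →
  φRf f u ≡ just s → φRf f v ≡ just t → φRf (suc f) (reverse u ++ m ∷ v) ≡ just (node2 m s t)
φRf-reverse-++-∷ {u} {v} {m} f u≢[] v≢[] u<m v<m φu φv =
  trans (φRf-node2 f (reverse-≢-[] u≢[]) v≢[] (All-reverse u<m) v<m)
        (cong₂ (Maybe.zipWith (node2 m)) (trans (cong (φRf f) (reverse-involutive u)) φu) φv)

φRf-ψR : ∀ T → Unique (labels T) → Decreasing T → ∀ f → length (ψR T) ≤ f →
  ∃ λ T′ → φRf f (ψR T) ≡ just T′ × T′ ≈T T
φRf-ψR T _ _ zero len≤ = ⊥-elim (<⇒≱ (≢-[]⇒0<length (ψR-≢-[] T)) len≤)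
φRf-ψR (node0 v) _ _ (suc f) _ = node0 v , refl , ≈0
φRf-ψR (node1 v t) (_ ∷ t!) (t<v , t-dec) (suc f) len≤
  with t′ , φt , t′≈t ← φRf-ψR t t! t-dec f (proj₁ (length-reverse-++-∷-≤ (ψR t) len≤)) =
  node1 v t′ ,
  trans (φRf-node1 f (reverse-≢-[] (ψR-≢-[] t)) (All-reverse (ψR-All t t<v)))
        (cong (Maybe.map (node1 v)) (trans (cong (φRf f) (reverse-involutive (ψR t))) φt)) ,
  ≈1 t′≈t
φRf-ψR (node2 v s t) st! (s<v , t<v , s-dec , t-dec) (suc f) len≤
  with s! , t! ← Unique-children v s t st! with <-cmp (lastD (ψR s)) (lastD (ψR t))
... | tri< lt _ _
  with eq ← ψ2-< v (ψR s) (ψR t) lt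
  with s-len , t-len ← length-reverse-++-∷-≤ (ψR s) (subst (λ z → length z ≤ suc f) eq len≤)
  with s′ , φs , s′≈s ← φRf-ψR s s! s-dec f s-len | t′ , φt , t′≈t ← φRf-ψR t t! t-dec f t-len =
  node2 v s′ t′ ,
  trans (cong (φRf (suc f)) eq)
        (φRf-reverse-++-∷ f (ψR-≢-[] s) (ψR-≢-[] t) (ψR-All s s<v) (ψR-All t t<v) φs φt) ,
  ≈2 (inj₁ (s′≈s , t′≈t))
... | tri≈ _ eq _ = ⊥-elim (lastD-ψR-children-≢ v s t st! eq)
... | tri> _ _ gt
  with eq ← ψ2-≮ v (ψR s) (ψR t) (<⇒≯ gt)
  with t-len , s-len ← length-reverse-++-∷-≤ (ψR t) (subst (λ z → length z ≤ suc f) eq len≤)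
  with s′ , φs , s′≈s ← φRf-ψR s s! s-dec f s-len | t′ , φt , t′≈t ← φRf-ψR t t! t-dec f t-len =
  node2 v t′ s′ ,
  trans (cong (φRf (suc f)) eq)
        (φRf-reverse-++-∷ f (ψR-≢-[] t) (ψR-≢-[] s) (ψR-All t t<v) (ψR-All s s<v) φt φs) ,
  ≈2 (inj₂ (t′≈t , s′≈s))

Decodable : ℕ → List ℕ → Set
Decodable f w = ∃ λ T → φRf f w ≡ just T × 𝓓 w T × ψR T ≡ w

FirstBelowLast⇒lastD< : U ≢ [] → v ≢ [] → FirstBelowLast U v → lastD (reverse U) < lastD v
FirstBelowLast⇒lastD< {[]}    U≢[] _ _ = ⊥-elim (U≢[] refl)
FirstBelowLast⇒lastD< {k ∷ U} {v} _ v≢[] cross with reverseView v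
... | []            = ⊥-elim (v≢[] refl)
... | V′ ∶ _ ∶ʳ b  = subst₂ _<_ (sym (lastD-reverse-∷ k U)) (sym (lastD-++-∷ V′)) (cross k U V′ b refl refl)

decodable-node1 : U ≢ [] → All (_< m) U → Decodable f (reverse U) → Decodable (suc f) (U ++ [ m ])
decodable-node1 {U} {m} {f} U≢[] U<m (T , φ≡ , (T↭ , T-dec) , ψ≡) =
  node1 m T ,
  trans (φRf-node1 f U≢[] U<m) (cong (Maybe.map (node1 m)) φ≡) ,
  (↭-trans (prep m T↭U) (++-comm [ m ] U) , All-resp-↭ (↭-sym T↭U) U<m , T-dec) ,
  trans (cong (λ z → reverse z ++ [ m ]) ψ≡) (cong (_++ [ m ]) (reverse-involutive U))
  where
  T↭U = ↭-trans T↭ (↭-reverse U)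

decodable-node2 : U ≢ [] → v ≢ [] → All (_< m) U → All (_< m) v → FirstBelowLast U v →
  Decodable f (reverse U) → Decodable f v → Decodable (suc f) (U ++ m ∷ v)
decodable-node2 {U} {v} {m} {f} U≢[] v≢[] U<m v<m cross
                (T , φT , (T↭ , T-dec) , ψT) (T′ , φT′ , (T′↭ , T′-dec) , ψT′) =
  node2 m T T′ ,
  trans (φRf-node2 f U≢[] v≢[] U<m v<m) (cong₂ (Maybe.zipWith (node2 m)) φT φT′) ,
  (↭-trans (prep m (↭-++⁺ T↭U T′↭)) (↭-sym (shift m U v)) ,
   All-resp-↭ (↭-sym T↭U) U<m , All-resp-↭ (↭-sym T′↭) v<m , T-dec , T′-dec) ,
  (begin
    ψ2 m (ψR T) (ψR T′)          ≡⟨ cong₂ (ψ2 m) ψT ψT′ ⟩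
    ψ2 m (reverse U) v           ≡⟨ ψ2-< m (reverse U) v (FirstBelowLast⇒lastD< U≢[] v≢[] cross) ⟩
    reverse (reverse U) ++ m ∷ v ≡⟨ cong (_++ m ∷ v) (reverse-involutive U) ⟩
    U ++ m ∷ v                   ∎)
  where
  open ≡-Reasoning
  T↭U = ↭-trans T↭ (↭-reverse U)

DecodesUpTo : ℕ → Set
DecodesUpTo f = ∀ w → length w ≤ f → w ≢ [] → Unique w → Admissible _<_ w → Decodable f w

module _ (decode : DecodesUpTo f) (len≤ : length (U ++ m ∷ v) ≤ suc f)
         (w! : Unique (U ++ m ∷ v)) (w-adm : Admissible _<_ (U ++ m ∷ v)) where

  decodable-left : U ≢ [] → All (_< m) U → Decodable f (reverse U)
  decodable-left U≢[] U<m =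
    decode (reverse U) (subst (_≤ f) (sym (length-reverse U)) (proj₁ (length-++-∷-≤ U len≤)))
           (reverse-≢-[] U≢[]) (Unique-reverse (Unique-++⁻ˡ U w!)) (Admissible-reverse (split-left w! w-adm U<m))

  decodable-right : v ≢ [] → All (_< m) v → Decodable f v
  decodable-right v≢[] v<m =
    decode v (proj₂ (length-++-∷-≤ U len≤)) v≢[] (Unique-++-∷⁻ʳ U w!) (split-right w! w-adm v<m)

decodable-split : DecodesUpTo f → w ≡ U ++ m ∷ v → All (_< m) U → All (_< m) v →
  length w ≤ suc f → 2 ≤ length w → Unique w → Admissible _<_ w → Decodable (suc f) w
decodable-split {U = []} _ refl _ v<m _ 2≤ _ w-adm with refl ← Admissible-∷-max⇒[] v<m w-adm =
  ⊥-elim (<⇒≱ (n<1+n 1) 2≤)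
decodable-split {U = k ∷ U} {v = []} decode refl U<m _ len≤ _ w! w-adm =
  decodable-node1 (λ ()) U<m (decodable-left decode len≤ w! w-adm (λ ()) U<m)
decodable-split {U = k ∷ U} {v = a ∷ v} decode refl U<m v<m len≤ _ w! w-adm =
  decodable-node2 (λ ()) (λ ()) U<m v<m (split-cross w! w-adm)
    (decodable-left decode len≤ w! w-adm (λ ()) U<m)
    (decodable-right {U = k ∷ U} decode len≤ w! w-adm (λ ()) v<m)

φRf-decodable : ∀ f → DecodesUpTo f
φRf-decodable zero    w           len≤ w≢[] _ _ = ⊥-elim (<⇒≱ (≢-[]⇒0<length w≢[]) len≤)
φRf-decodable (suc f) []          _    w≢[] _ _ = ⊥-elim (w≢[] refl)
φRf-decodable (suc f) (x ∷ [])    _    _    _ _ = node0 x , refl , (↭-refl , _) , refl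
φRf-decodable (suc f) (x ∷ y ∷ u) len≤ _    w! w-adm
  with U , V , w≡ , U<m , V<m ← split-at-max w! (All.tabulate maxL-upper) (maxL-∈ x (y ∷ u)) =
  decodable-split (φRf-decodable f) w≡ U<m V<m len≤ (s≤s (s≤s z≤n)) w! w-adm

module _ {P : List ℕ} (P! : Unique P) where

  private
    M+1<M+2 : maxL P + 1 < maxL P + 2
    M+1<M+2 = +-monoʳ-< (maxL P) (n<1+n 1)

    below : w ↭ P → All (_< maxL P + 1) w
    below w↭P = All.tabulate λ {z} z∈ →
      subst (z <_) (+-comm 1 (maxL P)) (s≤s (maxL-upper (∈-resp-↭ w↭P z∈)))

  φR-R′ : 1 ≤ length P → R′ P w → ∃ λ T → φR w ≡ just T × 𝓓 P T × ψR T ≡ w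
  φR-R′ {w} 1≤P (w↭P , W-prim) =
    let T , φ≡ , (T↭w , T-dec) , ψ≡ = φRf-decodable (length w) w ≤-refl w≢[] w! w-adm
    in  T , φ≡ , (↭-trans T↭w w↭P , T-dec) , ψ≡
    where
    w! = Unique-resp-↭ (↭-sym w↭P) P!
    w-adm = IsPrimRWord⇒Admissible M+1<M+2 (below w↭P) w! W-prim
    w≢[] : w ≢ []
    w≢[] w≡[] = <⇒≱ 1≤P (≤-reflexive (trans (sym (↭-length w↭P)) (cong length w≡[])))

  ψR-𝓓 : 𝓓 P T → R′ P (ψR T) × ∃ λ T′ → φR (ψR T) ≡ just T′ × T′ ≈T T
  ψR-𝓓 {T} (T↭P , T-dec) =
    (ψ↭P , Admissible⇒IsPrimRWord M+1<M+2 (below ψ↭P) (Unique-resp-↭ (↭-sym ψ↭P) P!)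
                                  (ψR-admissible T T! T-dec)) ,
    φRf-ψR T T! T-dec (length (ψR T)) ≤-refl
    where
    T! = Unique-resp-↭ (↭-sym T↭P) P!
    ψ↭P = ↭-trans (ψR-↭ T) T↭P

  ψR-≈T : ∀ T T′ → 𝓓 P T → T ≈T T′ → ψR T ≡ ψR T′
  ψR-≈T T T′ (T↭P , _) = ψR-cong T T′ (Unique-resp-↭ (↭-sym T↭P) P!)

theorem9 : (n : ℕ) → 1 ≤ n →
    ((w : List ℕ) → R′ [ n ]ₙ w →
       Σ Tree (λ T → φR w ≡ just T × 𝓓 [ n ]ₙ T × ψR T ≡ w))
    × ((T : Tree) → 𝓓 [ n ]ₙ T →
       R′ [ n ]ₙ (ψR T) × Σ Tree (λ T′ → φR (ψR T) ≡ just T′ × T′ ≈T T))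
    × ((T T′ : Tree) → 𝓓 [ n ]ₙ T → T ≈T T′ → ψR T ≡ ψR T′)
theorem9 n 1≤n = (λ _ → φR-R′ [n]! 1≤length) , (λ _ → ψR-𝓓 [n]!) , ψR-≈T [n]!
  where
  [n]! : Unique [ n ]ₙ
  [n]! = Unique.applyUpTo⁺₁ suc n (λ i<j _ → <⇒≢ i<j ∘′ suc-injective)
  1≤length : 1 ≤ length [ n ]ₙ
  1≤length = subst (1 ≤_) (sym (length-applyUpTo suc n)) 1≤n
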